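{- Cellular automata together with cellular morphisms form a category, with composition $(g,r)\circ(f,s)=(g\circ f,\ r\circ s)$ and identities $(\mathrm{id}_X,\mathrm{id}_{X^*})$. Moreover, the assignment that is the identity on objects and sends a cellular morphism $(f,s)$ to $f$ is a conservative functor from this category to the category of cellular automata and pre-cellular morphisms (i.e. $(f,s)$ is an isomorphism whenever $f$ is).
   Context: Fix a monoid $(M,\cdot,e)$, a subset $N\subseteq M$ with inclusion $i\colon N\hookrightarrow M$, and a set $S$ of states. $[A,B]$ is the set of maps $A\to B$. For $a\colon M\to X$ let $I^a\subseteq[N,S]$ be the set of $f\colon N\to S$ with $f(n)=f(n')$ whenever $a(i(n))=a(i(n'))$; for $h\colon X\to Y$, $I^{h\circ a}\subseteq I^a$. Let $CX=\coprod_{a\colon M\to X}[I^a,S]$, $(Ch)(a,f)=(h\circ a, f|_{I^{h\circ a}})$. A cellular automaton is $\gamma\colon X\to CX$, $\gamma(x)=(\gamma_1(x),\gamma_2(x))$ with $\gamma_1(x)\colon M\to X$, $\gamma_2(x)\colon I^{\gamma_1(x)}\to S$, such that $\gamma_1(x)(e)=x$ and $\gamma_1(\gamma_1(x)(m))(n)=\gamma_1(x)(n\cdot m)$. A pre-cellular morphism $h\colon\gamma\to\delta$ is a map with $Ch\circ\gamma=\delta\circ h$; these form a category. Configurations $X^*=[X,S]$; for $h\colon X\to Y$, $h^*\colon Y^*\to X^*$, $h^*(c)=c\circ h$. A cellular morphism $\gamma\to\delta$ (with $\gamma\colon X\to CX$, $\delta\colon Y\to CY$) is a pair $(f,s)$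 with $f\colon X\to Y$ a pre-cellular morphism and $s\colon X^*\to Y^*$ a section of $f^*$, i.e. $f^*\circ s=\mathrm{id}_{X^*}$. -}

module Defs where

open import Data.Product using (Σ; _×_; _,_; proj₁; proj₂)
open import Function using (_∘_; id)
open import Function.Definitions using (Injective)
open import Relation.Binary.PropositionalEquality using (_≡_; cong)
open import Algebra.Structures using (IsMonoid)

record Setting : Set₁ where
  field
    M        : Set
    _·_      : M → M → M
    e        : M
    isMonoid : IsMonoid _≡_ _·_ e
    N        : Set
    i        : N → M
    i-inj    : Injective _≡_ _≡_ i
    S        : Set

module Theory (T : Setting) where
  open Setting T

  Compat : {X : Set} → (M → X) → (N → S) → Set
  Compat a f = ∀ n n' → a (i n) ≡ a (i n') → f n ≡ f n'

  -- I^a ⊆ [N,S]; membership proof is irrelevant (it is a subset, not extra data)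
  record I {X : Set} (a : M → X) : Set where
    constructor mkI
    field
      fun     : N → S
      .compat : Compat a fun
  open I public

  incl : {X Y : Set} (h : X → Y) (a : M → X) → I (h ∘ a) → I a
  incl h a (mkI f p) = mkI f (λ n n' q → p n n' (cong h q))

  C : Set → Set
  C X = Σ (M → X) (λ a → I a → S)

  Cmap : {X Y : Set} → (X → Y) → C X → C Y
  Cmap h (a , F) = (h ∘ a , λ u → F (incl h a u))

  _≈C_ : {X : Set} → C X → C X → Set
  (a , F) ≈C (a' , F') =
    (∀ m → a m ≡ a' m) ×
    (∀ (f : N → S) .(p : Compat a f) .(p' : Compat a' f) → F (mkI f p) ≡ F' (mkI f p'))

  record CA : Set₁ where
    field
      X     : Set
      γ     : X → C X
      unit  : ∀ x → proj₁ (γ x) e ≡ x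
      act   : ∀ x m n → proj₁ (γ (proj₁ (γ x) m)) n ≡ proj₁ (γ x) (n · m)
  open CA public

  PreCellular : (γ δ : CA) → (X γ → X δ) → Set
  PreCellular γ δ h = ∀ x → Cmap h (CA.γ γ x) ≈C CA.γ δ (h x)

  Conf : Set → Set
  Conf X = X → S

  _* : {X Y : Set} → (X → Y) → Conf Y → Conf X
  (h *) c = c ∘ h

  IsSection : {X Y : Set} → (X → Y) → (Conf X → Conf Y) → Set
  IsSection f s = ∀ (c : Conf _) x → (f *) (s c) x ≡ c x

  IsCellular : (γ δ : CA) → (X γ → X δ) → (Conf (X γ) → Conf (X δ)) → Set
  IsCellular γ δ f s = PreCellular γ δ f × IsSection f s

  _≈M_ : {X Y : Set} → (X → Y) × (Conf X → Conf Y) → (X → Y) × (Conf X → Conf Y) → Set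
  (f , s) ≈M (f' , s') = (∀ x → f x ≡ f' x) × (∀ c y → s c y ≡ s' c y)

  _⊚_ : {X Y Z : Set} → (Y → Z) × (Conf Y → Conf Z) → (X → Y) × (Conf X → Conf Y)
      → (X → Z) × (Conf X → Conf Z)
  (g , r) ⊚ (f , s) = (g ∘ f , r ∘ s)

  idM : (X : Set) → (X → X) × (Conf X → Conf X)
  idM X = (id , id)

  IsoPre : (γ δ : CA) → (X γ → X δ) → Set
  IsoPre γ δ f = Σ (X δ → X γ) λ g →
    PreCellular δ γ g × (∀ x → g (f x) ≡ x) × (∀ y → f (g y) ≡ y)

  IsoCell : (γ δ : CA) → (X γ → X δ) → (Conf (X γ) → Conf (X δ)) → Set
  IsoCell γ δ f s = Σ (X δ → X γ) λ g → Σ (Conf (X δ) → Conf (X γ)) λ r →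
    IsCellular δ γ g r ×
    (((g , r) ⊚ (f , s)) ≈M idM (X γ)) ×
    (((f , s) ⊚ (g , r)) ≈M idM (X δ))

{-# OPTIONS --safe #-}
-- Apart from conservativity everything is componentwise: pre-cellular maps
-- compose because C is a functor, and sections of f* and g* compose to a
-- section of (g ∘ f)* = f* ∘ g*.  For conservativity, let g be the inverse
-- of f.  Then f* is invertible with inverse g*, so its section s is forced to
-- be g*, and (g , f*) is the inverse cellular morphism.
module Submission where

open import Defs
open import Data.Product using (_×_; _,_; proj₁; proj₂)
open import Function using (_∘_; id)
open import Relation.Binary.PropositionalEquality using (_≡_; refl; sym; trans; cong; module ≡-Reasoning)
open ≡-Reasoning

module CellularCategory (T : Setting) where
  open Setting T
  open Theory T

  Compat-resp : {X : Set} {a a' : M → X} {f : N → S} →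
                (∀ m → a m ≡ a' m) → Compat a f → Compat a' f
  Compat-resp a≗a' p n n' q = p n n' (trans (a≗a' (i n)) (trans q (sym (a≗a' (i n')))))

  ≈C-refl : {X : Set} (c : C X) → c ≈C c
  ≈C-refl c = (λ _ → refl) , (λ _ _ _ → refl)

  ≈C-trans : {X : Set} {c c' c'' : C X} → c ≈C c' → c' ≈C c'' → c ≈C c''
  ≈C-trans (a≗a' , F≈F') (a'≗a'' , F'≈F'') =
    (λ m → trans (a≗a' m) (a'≗a'' m)) ,
    (λ f p p'' → trans (F≈F' f p (Compat-resp a≗a' p)) (F'≈F'' f (Compat-resp a≗a' p) p''))

  Cmap-cong : {X Y : Set} (h : X → Y) {c c' : C X} → c ≈C c' → Cmap h c ≈C Cmap h c'
  Cmap-cong h (a≗a' , F≈F') =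
    (λ m → cong h (a≗a' m)) ,
    (λ f p p' → F≈F' f (λ n n' q → p n n' (cong h q)) (λ n n' q → p' n n' (cong h q)))

  precellular-id : (γ : CA) → PreCellular γ γ id
  precellular-id γ x = ≈C-refl (CA.γ γ x)

  precellular-∘ : (γ δ ε : CA) (f : X γ → X δ) (g : X δ → X ε) →
                  PreCellular γ δ f → PreCellular δ ε g → PreCellular γ ε (g ∘ f)
  -- Cmap (g ∘ f) c and Cmap g (Cmap f c) agree definitionally, the
  -- compatibility proofs carried by I being irrelevant.
  precellular-∘ γ δ ε f g f-pre g-pre x =
    ≈C-trans {c = Cmap (g ∘ f) (CA.γ γ x)} {c' = Cmap g (CA.γ δ (f x))} {c'' = CA.γ ε (g (f x))}
      (Cmap-cong g {c = Cmap f (CA.γ γ x)} {c' = CA.γ δ (f x)} (f-pre x))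
      (g-pre (f x))

  isSection-id : (X : Set) → IsSection {X} id id
  isSection-id X c x = refl

  isSection-∘ : {X Y Z : Set} (f : X → Y) (s : Conf X → Conf Y) (g : Y → Z) (r : Conf Y → Conf Z) →
                IsSection f s → IsSection g r → IsSection (g ∘ f) (r ∘ s)
  isSection-∘ f s g r s-sec r-sec c x = trans (r-sec (s c) (f x)) (s-sec c x)

  isCellular-id : (γ : CA) → IsCellular γ γ id id
  isCellular-id γ = precellular-id γ , isSection-id (X γ)

  isCellular-∘ : (γ δ ε : CA) (f : X γ → X δ) (s : Conf (X γ) → Conf (X δ))
                 (g : X δ → X ε) (r : Conf (X δ) → Conf (X ε)) →
                 IsCellular γ δ f s → IsCellular δ ε g r → IsCellular γ ε (g ∘ f) (r ∘ s)
  isCellular-∘ γ δ ε f s g r (f-pre , s-sec) (g-pre , r-sec) =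
    precellular-∘ γ δ ε f g f-pre g-pre , isSection-∘ f s g r s-sec r-sec

  ⊚-assoc : {W X Y Z : Set} (h : (Y → Z) × (Conf Y → Conf Z)) (g : (X → Y) × (Conf X → Conf Y))
            (f : (W → X) × (Conf W → Conf X)) → ((h ⊚ g) ⊚ f) ≈M (h ⊚ (g ⊚ f))
  ⊚-assoc _ _ _ = (λ _ → refl) , (λ _ _ → refl)

  ⊚-identityˡ : {X Y : Set} (f : (X → Y) × (Conf X → Conf Y)) → (idM Y ⊚ f) ≈M f
  ⊚-identityˡ _ = (λ _ → refl) , (λ _ _ → refl)

  ⊚-identityʳ : {X Y : Set} (f : (X → Y) × (Conf X → Conf Y)) → (f ⊚ idM X) ≈M f
  ⊚-identityʳ _ = (λ _ → refl) , (λ _ _ → refl)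

  isSection-*-of-rightInverse : {X Y : Set} (f : X → Y) (g : Y → X) →
                                (∀ y → f (g y) ≡ y) → IsSection g (f *)
  isSection-*-of-rightInverse f g fg c y = cong c (fg y)

  section-unique : {X Y : Set} (f : X → Y) (g : Y → X) (s : Conf X → Conf Y) →
                   (∀ y → f (g y) ≡ y) → IsSection f s → ∀ c y → s c y ≡ (g *) c y
  section-unique f g s fg s-sec c y = begin
    s c y           ≡⟨ cong (s c) (sym (fg y)) ⟩
    s c (f (g y))   ≡⟨ s-sec c (g y) ⟩
    c (g y)         ∎

  IsoPre⇒IsoCell : (γ δ : CA) (f : X γ → X δ) (s : Conf (X γ) → Conf (X δ)) →
                   IsSection f s → IsoPre γ δ f → IsoCell γ δ f s
  IsoPre⇒IsoCell γ δ f s s-sec (g , g-pre , gf , fg) =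
    g , f * , (g-pre , f*-sec) , (gf , s-sec) ,
    (fg , λ c y → trans (section-unique f g s fg s-sec ((f *) c) y) (f*-sec c y))
    where
    f*-sec : IsSection g (f *)
    f*-sec = isSection-*-of-rightInverse f g fg

lemma4 : (T : Setting) → let open Theory T in
  -- identities are cellular morphisms
  (∀ (γ : CA) → IsCellular γ γ id id) ×
  -- composites of cellular morphisms are cellular morphisms
  (∀ (γ δ ε : CA) f s g r → IsCellular γ δ f s → IsCellular δ ε g r
    → IsCellular γ ε (g ∘ f) (r ∘ s)) ×
  -- category laws
  (∀ (γ δ ε ζ : CA) (f : X γ → X δ) (s : Conf (X γ) → Conf (X δ))
    (g : X δ → X ε) (r : Conf (X δ) → Conf (X ε))
    (h : X ε → X ζ) (t : Conf (X ε) → Conf (X ζ))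
    → (((h , t) ⊚ (g , r)) ⊚ (f , s)) ≈M ((h , t) ⊚ ((g , r) ⊚ (f , s)))) ×
  (∀ (γ δ : CA) (f : X γ → X δ) (s : Conf (X γ) → Conf (X δ))
    → ((idM (X δ) ⊚ (f , s)) ≈M (f , s)) × (((f , s) ⊚ idM (X γ)) ≈M (f , s))) ×
  -- (f , s) ↦ f lands in pre-cellular morphisms and preserves identities and composition
  (∀ (γ δ : CA) f s → IsCellular γ δ f s → PreCellular γ δ f) ×
  (∀ (γ : CA) (x : X γ) → proj₁ (idM (X γ)) x ≡ x) ×
  (∀ (γ δ ε : CA) (f : X γ → X δ) (s : Conf (X γ) → Conf (X δ))
    (g : X δ → X ε) (r : Conf (X δ) → Conf (X ε))
    → ∀ x → proj₁ ((g , r) ⊚ (f , s)) x ≡ g (f x)) ×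
  -- conservativity: (f , s) is an isomorphism whenever f is
  (∀ (γ δ : CA) f s → IsCellular γ δ f s → IsoPre γ δ f → IsoCell γ δ f s)
lemma4 T =
  isCellular-id ,
  isCellular-∘ ,
  (λ _ _ _ _ f s g r h t → ⊚-assoc (h , t) (g , r) (f , s)) ,
  (λ _ _ f s → ⊚-identityˡ (f , s) , ⊚-identityʳ (f , s)) ,
  (λ _ _ _ _ → proj₁) ,
  (λ _ _ → refl) ,
  (λ _ _ _ _ _ _ _ _ → refl) ,
  (λ γ δ f s → IsoPre⇒IsoCell γ δ f s ∘ proj₂)
  where open CellularCategory T
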